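{- Let $S$ be an equivariant system of ideals for a commutative preordered group $G$ and $x\in G$. For every nonempty finite subset $A$ of $G$, $T_x(S)(A)$ holds iff there exists an integer $k\geqslant 0$ such that $S(A,A-x,A-2x,\dots,A-kx)$.
   Context: $G$ is an abelian group with a preorder $\leqslant$ such that $a\leqslant b$ implies $a+c\leqslant b+c$. For nonempty finite subsets write $A,B$ for $A\cup B$, $a$ for $\{a\}$, $A-y=\{a-y:a\in A\}$. An equivariant system of ideals is a predicate $S$ on nonempty finite subsets of $G$ such that: (P1) $S(A)$ if $A\supseteq A'$ and $S(A')$; (P2') $S(A)$ if $S(A,u)$ and $S(A-u)$; (P3) $S(a)$ if $a\leqslant 0$. $Q$ contains $S$ if $S(A)$ implies $Q(A)$. $T_x(S)$ is the least equivariant system of ideals $Q$ containing $S$ and such that $Q(x)$ (it exists since equivariant systems of ideals are closed under intersection). -}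

module Defs where

open import Level using (Level; _⊔_; suc)
open import Data.Nat using (ℕ; zero) renaming (suc to 1+)
open import Data.List.NonEmpty using (List⁺; [_]; _⁺++⁺_; toList) renaming (map to map⁺)
open import Algebra.Bundles using (AbelianGroup)
open import Relation.Binary.Structures using (IsPreorder)
import Algebra.Definitions.RawMonoid as RM
import Data.List.Membership.Setoid as Mem

record PreorderedAbelianGroup (c ℓ₁ ℓ₂ : Level) : Set (suc (c ⊔ ℓ₁ ⊔ ℓ₂)) where
  field
    abelianGroup : AbelianGroup c ℓ₁
  open AbelianGroup abelianGroup public
  field
    _≤_        : Carrier → Carrier → Set ℓ₂
    isPreorder : IsPreorder _≈_ _≤_
    ≤-compat   : ∀ {a b} c → a ≤ b → (a ∙ c) ≤ (b ∙ c)

module _ {c ℓ₁ ℓ₂ : Level} (G : PreorderedAbelianGroup c ℓ₁ ℓ₂) where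
  open PreorderedAbelianGroup G
  open Mem setoid using (_∈_)

  -- nonempty finite subsets of G, represented by nonempty lists
  FinSub : Set c
  FinSub = List⁺ Carrier

  _⊇_ : FinSub → FinSub → Set (c ⊔ ℓ₁)
  A ⊇ B = ∀ {b} → b ∈ toList B → b ∈ toList A

  _,,_ : FinSub → FinSub → FinSub
  A ,, B = A ⁺++⁺ B

  _⊖_ : FinSub → Carrier → FinSub
  A ⊖ y = map⁺ (λ a → a ∙ (y ⁻¹)) A

  _·_ : ℕ → Carrier → Carrier
  _·_ = RM._×_ rawMonoid

  orbitUnion : FinSub → Carrier → ℕ → FinSub
  orbitUnion A x zero   = A
  orbitUnion A x (1+ k) = orbitUnion A x k ,, (A ⊖ (1+ k · x))

  record IsEquivariantSystem {ℓ} (S : FinSub → Set ℓ) : Set (c ⊔ ℓ₁ ⊔ ℓ₂ ⊔ ℓ) where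
    field
      P1  : ∀ A A′ → A ⊇ A′ → S A′ → S A
      P2′ : ∀ A u → S (A ,, [ u ]) → S (A ⊖ u) → S A
      P3  : ∀ a → a ≤ ε → S [ a ]

  -- T_x(S): the least equivariant system of ideals containing S and with Q(x),
  -- given as the intersection of all such systems (of the same level as S).
  T : ∀ {ℓ} → Carrier → (FinSub → Set ℓ) → FinSub → Set (c ⊔ ℓ₁ ⊔ ℓ₂ ⊔ suc ℓ)
  T {ℓ} x S A = (Q : FinSub → Set ℓ) → IsEquivariantSystem Q
              → (∀ B → S B → Q B) → Q [ x ] → Q A

-- Write A[k] for A, A − x, …, A − kx.  The predicate A ↦ ∃ k. S(A[k]) is itself an
-- equivariant system of ideals: an instance of P2′ for it is obtained by gluing the
-- witnesses k₁ for (A, u) and k₂ for A − u into the witness k₂ + k₁ for A.  It contains S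
-- (k = 0) and holds at x (k = 1, as x − x ≤ 0), so it contains T_x(S).  Conversely,
-- if Q(x) then each element a − (k+1)x of the last block of A[k+1] can be removed by P2′,
-- because A[k] − (a − (k+1)x) contains a − kx − (a − (k+1)x) = x; hence Q(A[k]) implies Q(A).
module Submission where

open import Defs using (PreorderedAbelianGroup; FinSub; IsEquivariantSystem; T; orbitUnion)
import Defs
open import Level using (Level; _⊔_)
open import Data.Nat using (ℕ; zero; z≤n; s≤s; _+_) renaming (suc to 1+; _≤_ to _≤ℕ_)
open import Data.Nat.Properties using (≤-refl; ≤-trans; m≤n⇒m≤1+n; m≤n⇒m<n∨m≡n; m≤n+m; +-mono-≤)
open import Data.Product using (∃; _,_; _×_)
open import Data.Sum using (_⊎_; inj₁; inj₂; [_,_]′)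
open import Data.List using ([]; _∷_; _++_)
open import Data.List.NonEmpty using ([_]; _⁺++_; toList)
open import Data.List.Relation.Unary.Any using (here; there)
open import Function.Base using (id; _∘_)
open import Function.Bundles using (_⇔_; mk⇔)
open import Relation.Binary.PropositionalEquality using () renaming (refl to ≡-refl)
open import Relation.Binary.Structures using (IsPreorder)
import Data.List.Membership.Setoid as Membership
import Data.List.Membership.Setoid.Properties as MembershipProperties
import Algebra.Properties.AbelianGroup as AbelianGroupProperties
import Algebra.Properties.CommutativeSemigroup as CommutativeSemigroupProperties
import Algebra.Properties.Monoid.Mult as MultProperties
import Relation.Binary.Reasoning.Setoid as SetoidReasoning

module _ {c ℓ₁ ℓ₂ : Level} (G : PreorderedAbelianGroup c ℓ₁ ℓ₂) where
  open PreorderedAbelianGroup G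
  open AbelianGroupProperties abelianGroup
    using (⁻¹-anti-homo‿-; //-rightDividesʳ; ε⁻¹≈ε; x≈y⇒x∙y⁻¹≈ε)
  open CommutativeSemigroupProperties commutativeSemigroup using (interchange)
  open MultProperties monoid using (×-homo-+)
  open Membership setoid using (_∈_)
  open MembershipProperties using (∈-resp-≈; ∈-++⁺ˡ; ∈-++⁺ʳ; ∈-++⁻; ∈-map⁺; ∈-map⁻)
  open SetoidReasoning setoid

  private
    _,,_ : FinSub G → FinSub G → FinSub G
    _,,_ = Defs._,,_ G

    _⊖_ : FinSub G → Carrier → FinSub G
    _⊖_ = Defs._⊖_ G

    _⊇_ : FinSub G → FinSub G → Set (c ⊔ ℓ₁)
    _⊇_ = Defs._⊇_ G

    _·_ : ℕ → Carrier → Carrier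
    _·_ = Defs._·_ G

  -‿interchange : ∀ a m b n → (a - m) - (b - n) ≈ (a - b) - (m - n)
  -‿interchange a m b n = begin
    (a - m) - (b - n)          ≈⟨ ∙-congˡ (⁻¹-anti-homo‿- b n) ⟩
    (a ∙ m ⁻¹) ∙ (n ∙ b ⁻¹)    ≈⟨ ∙-congˡ (comm n (b ⁻¹)) ⟩
    (a ∙ m ⁻¹) ∙ (b ⁻¹ ∙ n)    ≈⟨ interchange a (m ⁻¹) (b ⁻¹) n ⟩
    (a ∙ b ⁻¹) ∙ (m ⁻¹ ∙ n)    ≈⟨ ∙-congˡ (comm (m ⁻¹) n) ⟩
    (a - b) ∙ (n - m)          ≈⟨ ∙-congˡ (⁻¹-anti-homo‿- m n) ⟨
    (a - b) - (m - n)          ∎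

  -‿cancelˡ : ∀ a m n → (a - m) - (a - n) ≈ n - m
  -‿cancelˡ a m n = begin
    (a - m) - (a - n)   ≈⟨ -‿interchange a m a n ⟩
    (a - a) - (m - n)   ≈⟨ ∙-congʳ (inverseʳ a) ⟩
    ε - (m - n)         ≈⟨ identityˡ _ ⟩
    (m - n) ⁻¹          ≈⟨ ⁻¹-anti-homo‿- m n ⟩
    n - m               ∎

  -‿identityʳ : ∀ a → a - ε ≈ a
  -‿identityʳ a = trans (∙-congˡ ε⁻¹≈ε) (identityʳ a)

  ·-+-difference : ∀ x i j → ((i + j) · x) - (j · x) ≈ i · x
  ·-+-difference x i j = trans (∙-congʳ (×-homo-+ x i j)) (//-rightDividesʳ (j · x) (i · x))

  ⊇-[_] : ∀ {A b} → b ∈ toList A → A ⊇ [ b ]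
  ⊇-[ b∈A ] (here y≈b) = ∈-resp-≈ setoid (sym y≈b) b∈A

  ∈-⊖⁺ : ∀ {a A} u → a ∈ toList A → (a - u) ∈ toList (A ⊖ u)
  ∈-⊖⁺ u = ∈-map⁺ setoid setoid ∙-congʳ

  ∈-⊖⁻ : ∀ {y} A u → y ∈ toList (A ⊖ u) → ∃ λ a → a ∈ toList A × y ≈ a - u
  ∈-⊖⁻ A u = ∈-map⁻ setoid setoid

  ⊖-mono : ∀ {A B} u → A ⊇ B → (A ⊖ u) ⊇ (B ⊖ u)
  ⊖-mono {B = B} u A⊇B y∈B-u with ∈-⊖⁻ B u y∈B-u
  ... | b , b∈B , y≈b-u = ∈-resp-≈ setoid (sym y≈b-u) (∈-⊖⁺ u (A⊇B b∈B))

  ∈-orbitUnion⁺ : ∀ {a} A x k j → j ≤ℕ k → a ∈ toList A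
                → (a - (j · x)) ∈ toList (orbitUnion G A x k)
  ∈-orbitUnion⁺ A x zero .zero z≤n a∈A =
    ∈-resp-≈ setoid (sym (-‿identityʳ _)) a∈A
  ∈-orbitUnion⁺ A x (1+ k) j j≤1+k a∈A with m≤n⇒m<n∨m≡n j≤1+k
  ... | inj₁ (s≤s j≤k) = ∈-++⁺ˡ setoid (∈-orbitUnion⁺ A x k j j≤k a∈A)
  ... | inj₂ ≡-refl    = ∈-++⁺ʳ setoid (toList (orbitUnion G A x k)) (∈-⊖⁺ _ a∈A)

  ∈-orbitUnion⁻ : ∀ {y} A x k → y ∈ toList (orbitUnion G A x k)
                → ∃ λ j → ∃ λ a → j ≤ℕ k × a ∈ toList A × y ≈ a - (j · x)
  ∈-orbitUnion⁻ {y} A x zero y∈A = 0 , y , z≤n , y∈A , sym (-‿identityʳ y)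
  ∈-orbitUnion⁻ A x (1+ k) y∈ with ∈-++⁻ setoid (toList (orbitUnion G A x k)) y∈
  ... | inj₁ y∈A[k] with ∈-orbitUnion⁻ A x k y∈A[k]
  ...   | j , a , j≤k , a∈A , y≈ = j , a , m≤n⇒m≤1+n j≤k , a∈A , y≈
  ∈-orbitUnion⁻ A x (1+ k) y∈ | inj₂ y∈A-kx with ∈-⊖⁻ A _ y∈A-kx
  ... | a , a∈A , y≈ = 1+ k , a , ≤-refl , a∈A , y≈

  orbitUnion-mono : ∀ {A B} x k → A ⊇ B → orbitUnion G A x k ⊇ orbitUnion G B x k
  orbitUnion-mono {A} {B} x k A⊇B y∈B[k] with ∈-orbitUnion⁻ B x k y∈B[k]
  ... | j , b , j≤k , b∈B , y≈ = ∈-resp-≈ setoid (sym y≈) (∈-orbitUnion⁺ A x k j j≤k (A⊇B b∈B))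

  ⊖-orbitUnion-⊇ : ∀ A u x k j {m l} → j ≤ℕ m → l ≈ u - (j · x)
                 → (orbitUnion G A x (k + m) ⊖ l) ⊇ orbitUnion G (A ⊖ u) x k
  ⊖-orbitUnion-⊇ A u x k j {m} {l} j≤m l≈ {y} y∈ with ∈-orbitUnion⁻ (A ⊖ u) x k y∈
  ... | i , d , i≤k , d∈A-u , y≈ with ∈-⊖⁻ A u d∈A-u
  ... | a , a∈A , d≈ = ∈-resp-≈ setoid a-⟨i+j⟩x-l≈y
        (∈-⊖⁺ l (∈-orbitUnion⁺ A x (k + m) (i + j) (+-mono-≤ i≤k j≤m) a∈A))
    where
    a-⟨i+j⟩x-l≈y : (a - ((i + j) · x)) - l ≈ y
    a-⟨i+j⟩x-l≈y = begin
      (a - ((i + j) · x)) - l              ≈⟨ ∙-congˡ (⁻¹-cong l≈) ⟩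
      (a - ((i + j) · x)) - (u - (j · x))  ≈⟨ -‿interchange a ((i + j) · x) u (j · x) ⟩
      (a - u) - (((i + j) · x) - (j · x))  ≈⟨ ∙-congˡ (⁻¹-cong (·-+-difference x i j)) ⟩
      (a - u) - (i · x)                    ≈⟨ ∙-congʳ (sym d≈) ⟩
      d - (i · x)                          ≈⟨ sym y≈ ⟩
      y                                    ∎

  ∈-++-∷⁻ : ∀ xs {l ys y} → y ∈ xs ++ l ∷ ys → y ≈ l ⊎ y ∈ xs ++ ys
  ∈-++-∷⁻ xs y∈ with ∈-++⁻ setoid xs y∈
  ... | inj₁ y∈xs         = inj₂ (∈-++⁺ˡ setoid y∈xs)
  ... | inj₂ (here y≈l)   = inj₁ y≈l
  ... | inj₂ (there y∈ys) = inj₂ (∈-++⁺ʳ setoid xs y∈ys)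

  ⁺++-[]-⊆ : ∀ B → B ⊇ (B ⁺++ [])
  ⁺++-[]-⊆ B = [ id , (λ ()) ]′ ∘ ∈-++⁻ setoid (toList B)

  ⁺++-∷-⊆ : ∀ B {l} Ls → l ∈ toList B → (B ⁺++ Ls) ⊇ (B ⁺++ (l ∷ Ls))
  ⁺++-∷-⊆ B Ls l∈B =
    [ (λ y≈l → ∈-++⁺ˡ setoid (∈-resp-≈ setoid (sym y≈l) l∈B)) , id ]′ ∘ ∈-++-∷⁻ (toList B)

  ⁺++-∷-⊆-,, : ∀ B l Ls → ((B ⁺++ Ls) ,, [ l ]) ⊇ (B ⁺++ (l ∷ Ls))
  ⁺++-∷-⊆-,, B l Ls =
    [ (λ y≈l → ∈-++⁺ʳ setoid (toList (B ⁺++ Ls)) (here y≈l)) , ∈-++⁺ˡ setoid ]′ ∘ ∈-++-∷⁻ (toList B)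

  module _ {ℓ} {Q : FinSub G → Set ℓ} (Q-sys : IsEquivariantSystem G Q) where
    open IsEquivariantSystem Q-sys

    -- An l with Q(B − l) is dropped by P2′ applied to (B, L) and l.
    ⁺++-discard : ∀ B Ls → (∀ {l} → l ∈ Ls → l ∈ toList B ⊎ Q (B ⊖ l)) → Q (B ⁺++ Ls) → Q B
    ⁺++-discard B []       _         QB  = P1 _ _ (⁺++-[]-⊆ B) QB
    ⁺++-discard B (l ∷ Ls) removable QBL =
      ⁺++-discard B Ls (removable ∘ there) (discard-l (removable (here refl)))
      where
      discard-l : l ∈ toList B ⊎ Q (B ⊖ l) → Q (B ⁺++ Ls)
      discard-l (inj₁ l∈B)  = P1 _ _ (⁺++-∷-⊆ B Ls l∈B) QBL
      discard-l (inj₂ QB-l) = P2′ (B ⁺++ Ls) l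
        (P1 _ _ (⁺++-∷-⊆-,, B l Ls) QBL)
        (P1 _ _ (⊖-mono l (∈-++⁺ˡ setoid)) QB-l)

    orbitUnion-peel : ∀ x → Q [ x ] → ∀ A k → Q (orbitUnion G A x k) → Q A
    orbitUnion-peel x Qx A zero      QA = QA
    orbitUnion-peel x Qx A (1+ k) QA[1+k] =
      orbitUnion-peel x Qx A k (⁺++-discard A[k] (toList (A ⊖ (1+ k · x))) removable QA[1+k])
      where
      A[k] = orbitUnion G A x k

      removable : ∀ {l} → l ∈ toList (A ⊖ (1+ k · x)) → l ∈ toList A[k] ⊎ Q (A[k] ⊖ l)
      removable {l} l∈ with ∈-⊖⁻ A _ l∈
      ... | a , a∈A , l≈ = inj₂ (P1 (A[k] ⊖ l) [ x ] ⊇-[ x∈A[k]-l ] Qx)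
        where
        x∈A[k]-l : x ∈ toList (A[k] ⊖ l)
        x∈A[k]-l = ∈-resp-≈ setoid a-kx-l≈x (∈-⊖⁺ l (∈-orbitUnion⁺ A x k k ≤-refl a∈A))
          where
          a-kx-l≈x : (a - (k · x)) - l ≈ x
          a-kx-l≈x = begin
            (a - (k · x)) - l                 ≈⟨ ∙-congˡ (⁻¹-cong l≈) ⟩
            (a - (k · x)) - (a - (1+ k · x))  ≈⟨ -‿cancelˡ a (k · x) (1+ k · x) ⟩
            (x ∙ (k · x)) - (k · x)           ≈⟨ //-rightDividesʳ (k · x) x ⟩
            x                                 ∎

  module _ {ℓ} {S : FinSub G → Set ℓ} (S-sys : IsEquivariantSystem G S) (x : Carrier) where
    open IsEquivariantSystem S-sys

    OrbitClosure : FinSub G → Set ℓ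
    OrbitClosure A = ∃ λ k → S (orbitUnion G A x k)

    OrbitClosure-P1 : ∀ A A′ → A ⊇ A′ → OrbitClosure A′ → OrbitClosure A
    OrbitClosure-P1 A A′ A⊇A′ (k , S[k]) = k , P1 _ _ (orbitUnion-mono x k A⊇A′) S[k]

    OrbitClosure-P2′ : ∀ A u → OrbitClosure (A ,, [ u ]) → OrbitClosure (A ⊖ u) → OrbitClosure A
    OrbitClosure-P2′ A u (k₁ , S⟨A,u⟩[k₁]) (k₂ , S⟨A-u⟩[k₂]) =
      k₂ + k₁ , ⁺++-discard S-sys A[K] (toList ⟨A,u⟩[k₁]) removable
                  (P1 _ ⟨A,u⟩[k₁] (∈-++⁺ʳ setoid (toList A[K])) S⟨A,u⟩[k₁])
      where
      A[K] = orbitUnion G A x (k₂ + k₁)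
      ⟨A,u⟩[k₁] = orbitUnion G (A ,, [ u ]) x k₁

      removable : ∀ {l} → l ∈ toList ⟨A,u⟩[k₁] → l ∈ toList A[K] ⊎ S (A[K] ⊖ l)
      removable {l} l∈ with ∈-orbitUnion⁻ (A ,, [ u ]) x k₁ l∈
      ... | j , b , j≤k₁ , b∈A,u , l≈ with ∈-++⁻ setoid (toList A) b∈A,u
      ...   | inj₁ b∈A = inj₁ (∈-resp-≈ setoid (sym l≈)
                (∈-orbitUnion⁺ A x (k₂ + k₁) j (≤-trans j≤k₁ (m≤n+m k₁ k₂)) b∈A))
      ...   | inj₂ (here b≈u) =
        inj₂ (P1 _ _ (⊖-orbitUnion-⊇ A u x k₂ j j≤k₁ (trans l≈ (∙-congʳ b≈u))) S⟨A-u⟩[k₂])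

    OrbitClosure-P3 : ∀ a → a ≤ ε → OrbitClosure [ a ]
    OrbitClosure-P3 a a≤ε = 0 , P3 a a≤ε

    OrbitClosure-isEquivariantSystem : IsEquivariantSystem G OrbitClosure
    OrbitClosure-isEquivariantSystem = record
      { P1 = OrbitClosure-P1 ; P2′ = OrbitClosure-P2′ ; P3 = OrbitClosure-P3 }

    OrbitClosure-[x] : OrbitClosure [ x ]
    OrbitClosure-[x] = 1 , P1 _ _ ⊇-[ x-x∈[x][1] ] (P3 _ x-x≤ε)
      where
      x-x∈[x][1] : (x - (1 · x)) ∈ toList (orbitUnion G [ x ] x 1)
      x-x∈[x][1] = ∈-orbitUnion⁺ [ x ] x 1 1 ≤-refl (here refl)

      x-x≤ε : (x - (1 · x)) ≤ ε
      x-x≤ε = IsPreorder.reflexive isPreorder (x≈y⇒x∙y⁻¹≈ε (sym (identityʳ x)))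

proposition4p2 : ∀ {c ℓ₁ ℓ₂ ℓ} (G : PreorderedAbelianGroup c ℓ₁ ℓ₂)
                 (S : FinSub G → Set ℓ) → IsEquivariantSystem G S
                 → (x : PreorderedAbelianGroup.Carrier G) (A : FinSub G)
                 → T G x S A ⇔ ∃ λ (k : ℕ) → S (orbitUnion G A x k)
proposition4p2 G S S-sys x A = mk⇔ T⇒OrbitClosure OrbitClosure⇒T
  where
  T⇒OrbitClosure : T G x S A → OrbitClosure G S-sys x A
  T⇒OrbitClosure TA = TA (OrbitClosure G S-sys x) (OrbitClosure-isEquivariantSystem G S-sys x)
                         (λ _ SB → 0 , SB) (OrbitClosure-[x] G S-sys x)

  OrbitClosure⇒T : OrbitClosure G S-sys x A → T G x S A
  OrbitClosure⇒T (k , S[k]) Q Q-sys S⊆Q Qx = orbitUnion-peel G Q-sys x Qx A k (S⊆Q _ S[k])
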